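{- Let $R\subseteq\mathbb{Z}$ be first-order definable over $(\mathbb{Z};+,1)$ such that the structure $(\mathbb{Z};+,R)$ is a core. (1) If $R^+\neq\emptyset$, then $\{1\}$ or $\{1,-1\}$ is primitive positive definable in $(\mathbb{Z};+,R)$. (2) If $R^+=\emptyset$, then $R^-=\emptyset$ or $R=\mathbb{Z}\setminus\{0\}$.
   Context: $+$ is the ternary relation $\{(x,y,z):x+y=z\}$. Endomorphisms of $(\mathbb{Z};+,R)$ are maps $x\mapsto\lambda x$; the structure is a core if every endomorphism is a self-embedding. Every unary $R\subseteq\mathbb{Z}$ first-order definable in $(\mathbb{Z};+,1)$ can be written $R=(R^\circ\cup R^+)\setminus R^-$ with $R^\circ$ a finite union of cosets of nontrivial subgroups of $\mathbb{Z}$ and $R^+,R^-$ finite disjoint sets; $R^+,R^-,R^\circ$ denote the unique such sets satisfying the convention $R^+\cap R^\circ=\emptyset$ and $R^-\subseteq R^\circ$. -}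

module Defs where

open import Level using (0ℓ)
open import Data.Nat using (ℕ; zero; suc)
open import Data.Integer using (ℤ; +_; _+_; _-_; -_)
open import Data.Integer.Divisibility using (_∣_)
open import Data.Fin using (Fin)
open import Data.List using (List)
open import Data.List.Membership.Propositional using (_∈_; _∉_)
open import Data.List.Relation.Unary.Any using (Any)
open import Data.List.Relation.Unary.All using (All)
open import Data.Product using (Σ; ∃; _×_; _,_)
open import Data.Sum using (_⊎_)
open import Data.Empty using (⊥)
open import Data.Unit using (⊤)
open import Relation.Nullary using (¬_)
open import Relation.Binary.PropositionalEquality using (_≡_; _≢_)
open import Function.Bundles using (_⇔_)
open import Function.Definitions using (Injective)

-- First-order logic over the signature (+ ternary relation, constant 1)
-- Variables are de Bruijn indices (ℕ); variable 0 is the free variable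
-- of a unary definition.

data FOFormula : Set where
  plusᶠ : ℕ → ℕ → ℕ → FOFormula
  oneᶠ  : ℕ → FOFormula
  eqᶠ   : ℕ → ℕ → FOFormula
  ⊤ᶠ ⊥ᶠ : FOFormula
  ¬ᶠ_   : FOFormula → FOFormula
  _∧ᶠ_ _∨ᶠ_ _⇒ᶠ_ : FOFormula → FOFormula → FOFormula
  ∃ᶠ ∀ᶠ : FOFormula → FOFormula

Env : Set
Env = ℕ → ℤ

extend : ℤ → Env → Env
extend v ρ zero    = v
extend v ρ (suc n) = ρ n

Sat : Env → FOFormula → Set
Sat ρ (plusᶠ i j k) = ρ i + ρ j ≡ ρ k
Sat ρ (oneᶠ i)      = ρ i ≡ + 1
Sat ρ (eqᶠ i j)     = ρ i ≡ ρ j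
Sat ρ ⊤ᶠ            = ⊤
Sat ρ ⊥ᶠ            = ⊥
Sat ρ (¬ᶠ φ)        = ¬ Sat ρ φ
Sat ρ (φ ∧ᶠ ψ)      = Sat ρ φ × Sat ρ ψ
Sat ρ (φ ∨ᶠ ψ)      = Sat ρ φ ⊎ Sat ρ ψ
Sat ρ (φ ⇒ᶠ ψ)      = Sat ρ φ → Sat ρ ψ
Sat ρ (∃ᶠ φ)        = ∃ λ v → Sat (extend v ρ) φ
Sat ρ (∀ᶠ φ)        = ∀ v → Sat (extend v ρ) φ

env₀ : ℤ → Env
env₀ x = extend x (λ _ → + 0)

FODefinable : (ℤ → Set) → Set
FODefinable R = Σ FOFormula λ φ → ∀ x → (R x ⇔ Sat (env₀ x) φ)

IsEndomorphism : (ℤ → Set) → (ℤ → ℤ) → Set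
IsEndomorphism R f =
  (∀ x y z → x + y ≡ z → f x + f y ≡ f z) × (∀ x → R x → R (f x))

IsSelfEmbedding : (ℤ → Set) → (ℤ → ℤ) → Set
IsSelfEmbedding R f =
  Injective _≡_ _≡_ f ×
  (∀ x y z → (x + y ≡ z) ⇔ (f x + f y ≡ f z)) ×
  (∀ x → R x ⇔ R (f x))

IsCore : (ℤ → Set) → Set
IsCore R = ∀ f → IsEndomorphism R f → IsSelfEmbedding R f

-- Primitive positive definitions in (ℤ; +, R), unary case.
-- A pp-formula with free variable 0 and existential variables 1..m is a
-- finite conjunction of atoms over the variables Fin (suc m).

data PPAtom (n : ℕ) : Set where
  plusᵖ : Fin n → Fin n → Fin n → PPAtom n
  relᵖ  : Fin n → PPAtom n
  eqᵖ   : Fin n → Fin n → PPAtom n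

HoldsPP : {n : ℕ} → (ℤ → Set) → (Fin n → ℤ) → PPAtom n → Set
HoldsPP R v (plusᵖ i j k) = v i + v j ≡ v k
HoldsPP R v (relᵖ i)      = R (v i)
HoldsPP R v (eqᵖ i j)     = v i ≡ v j

PPDefinable : (ℤ → Set) → (ℤ → Set) → Set
PPDefinable R S =
  Σ ℕ λ m → Σ (List (PPAtom (suc m))) λ atoms →
    ∀ x → (S x ⇔ ∃ λ (v : Fin (suc m) → ℤ) →
                   (v Fin.zero ≡ x) × All (HoldsPP R v) atoms)

-- A coset (suc d)ℤ + r of a nontrivial subgroup of ℤ, given by (d , r).
Coset : Set
Coset = ℕ × ℤ

InCoset : ℤ → Coset → Set
InCoset x (d , r) = (+ suc d) ∣ (x - r)

InCosets : List Coset → ℤ → Set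
InCosets cs x = Any (InCoset x) cs

IsDecomposition : (ℤ → Set) → List Coset → List ℤ → List ℤ → Set
IsDecomposition R R° R⁺ R⁻ =
  (∀ x → R x ⇔ ((InCosets R° x ⊎ x ∈ R⁺) × x ∉ R⁻)) ×
  (∀ x → x ∈ R⁺ → x ∉ R⁻) ×
  (∀ x → x ∈ R⁺ → ¬ InCosets R° x) ×
  (∀ x → x ∈ R⁻ → InCosets R° x)

IsOne : ℤ → Set
IsOne x = x ≡ + 1

IsPlusMinusOne : ℤ → Set
IsPlusMinusOne x = (x ≡ + 1) ⊎ (x ≡ - (+ 1))

module Submission where

-- Let R = (R° ∪ R⁺) ∖ R⁻ be a decomposition, P the product of the moduli of
-- the cosets in R°, and K a bound on the absolute values of the elements of
-- R⁺ ∪ R⁻.  Far from the origin (|x| > K) membership in R is membership in R°,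
-- which is invariant under adding multiples of P; every residue class modulo
-- P has a representative y with K < |y| ≤ K + P.  Since the structure is a
-- core, a multiplication x ↦ l·x preserving R must satisfy l ≠ 0 and reflect R.
--
-- (2) If R⁺ = ∅, multiplication by stretch = 1 + (K+1)P preserves R; reflecting R
--     forces R⁻ ⊆ {0}.  If moreover 0 ∈ R⁻, then multiplication by P maps every
--     x ≠ 0 into R, and reflecting R gives R = ℤ ∖ {0}.
-- (1) If R⁺ ≠ ∅, let S(l) say that l·w ∈ R for every w ∈ R with |w| ≤ K + P.
--     S is pp-definable (one existential variable per window element w,
--     forced to equal x·w).  Every l ∈ S preserves all of R, so by the core
--     property it reflects R; an element a ∈ R⁺ of maximal absolute value then
--     rules out |l| ≥ 2.  Hence S ⊆ {1, -1}, S ∋ 1, and S is {1} or {1, -1}.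

open import Defs
open import Data.Nat as ℕ using (ℕ; zero; suc; z≤n; s≤s)
import Data.Nat.Properties as ℕP
import Data.Nat.Divisibility as ℕD
open import Data.Integer as ℤ
  using (ℤ; +_; -[1+_]; _+_; _-_; -_; _*_; ∣_∣; 0ℤ; _%ℕ_; _/ℕ_)
import Data.Integer.Properties as ℤP
import Data.Integer.DivMod as ℤDM
import Data.Integer.Divisibility.Signed as S
open import Data.Integer.Tactic.RingSolver using (solve-∀)
open import Algebra.Properties.AbelianGroup ℤP.+-0-abelianGroup using (identityʳ-unique)
open import Data.Fin using (Fin; zero; suc; toℕ; fromℕ; fromℕ<; inject₁; _↑ˡ_)
open import Data.Fin.Properties using (all?; toℕ-↑ˡ; toℕ-fromℕ; toℕ-fromℕ<; toℕ-inject₁)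
open import Data.List using (List; []; _∷_; _++_; tabulate)
open import Data.List.Membership.Propositional using (_∈_; _∉_)
open import Data.List.Membership.DecPropositional ℤ._≟_ using (_∈?_)
open import Data.List.Relation.Unary.Any using (here; there; any?)
open import Data.List.Relation.Unary.All as All using (All; _∷_)
open import Data.List.Relation.Unary.All.Properties using (++⁺; ++⁻; tabulate⁺; tabulate⁻)
import Data.List.Extrema ℕP.≤-totalOrder as Extrema
open import Data.Product using (∃; _×_; _,_; proj₁; proj₂)
open import Data.Sum as Sum using (_⊎_; inj₁; inj₂)
open import Data.Empty using (⊥; ⊥-elim)
open import Relation.Nullary using (¬_; Dec; yes; no)
open import Relation.Nullary.Decidable using (map′; _×-dec_; _⊎-dec_; ¬?; _→-dec_)
open import Relation.Unary using (Decidable)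
open import Relation.Binary.PropositionalEquality
open import Function using (_∘_; case_of_)
open import Function.Bundles using (_⇔_; mk⇔; Equivalence)
open import Function.Definitions using (Injective)
open import Function.Construct.Composition using (_⇔-∘_)
open import Function.Construct.Symmetry using (⇔-sym)

∣x∣≤∣l*x∣ : ∀ l x → l ≢ 0ℤ → ∣ x ∣ ℕ.≤ ∣ l * x ∣
∣x∣≤∣l*x∣ l x l≢0 = begin
    ∣ x ∣             ≤⟨ ℕP.m≤n*m ∣ x ∣ ∣ l ∣ {{ℤ.≢-nonZero l≢0}} ⟩
    ∣ l ∣ ℕ.* ∣ x ∣   ≡⟨ ℤP.abs-* l x ⟨
    ∣ l * x ∣         ∎
  where open ℕP.≤-Reasoning

∣x∣<∣l*x∣ : ∀ l x → 2 ℕ.≤ ∣ l ∣ → x ≢ 0ℤ → ∣ x ∣ ℕ.< ∣ l * x ∣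
∣x∣<∣l*x∣ l x 2≤∣l∣ x≢0 = begin-strict
    ∣ x ∣             <⟨ ℕP.m<m*n ∣ x ∣ ∣ l ∣ {{ℤ.≢-nonZero x≢0}} 2≤∣l∣ ⟩
    ∣ x ∣ ℕ.* ∣ l ∣   ≡⟨ ℕP.*-comm ∣ x ∣ ∣ l ∣ ⟩
    ∣ l ∣ ℕ.* ∣ x ∣   ≡⟨ ℤP.abs-* l x ⟨
    ∣ l * x ∣         ∎
  where open ℕP.≤-Reasoning

unit-or-large : ∀ l → l ≢ 0ℤ → ¬ (2 ℕ.≤ ∣ l ∣) → IsPlusMinusOne l
unit-or-large (+ zero)        l≢0 _     = ⊥-elim (l≢0 refl)
unit-or-large (+ suc zero)    _   _     = inj₁ refl
unit-or-large (+ suc (suc n)) _   small = ⊥-elim (small (s≤s (s≤s z≤n)))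
unit-or-large -[1+ zero ]     _   _     = inj₂ refl
unit-or-large -[1+ suc n ]    _   small = ⊥-elim (small (s≤s (s≤s z≤n)))

infix 4 _≡_[mod_]
_≡_[mod_] : ℤ → ℤ → ℕ → Set
x ≡ y [mod m ] = + m S.∣ (y - x)

multiple-apart : ∀ {m x y} q → y ≡ x + q * + m → x ≡ y [mod m ]
multiple-apart {m} {x} {y} q y≡x+qm = S.divides q (begin
    y - x              ≡⟨ cong (_- x) y≡x+qm ⟩
    x + q * + m - x    ≡⟨ cancel x (q * + m) ⟩
    q * + m            ∎)
  where
    open ≡-Reasoning
    cancel : ∀ x z → x + z - x ≡ z
    cancel = solve-∀

≡mod-sym : ∀ {m x y} → x ≡ y [mod m ] → y ≡ x [mod m ]
≡mod-sym {m} {x} {y} m∣y-x = subst (+ m S.∣_) (negate-diff y x) (S.∣m⇒∣-m m∣y-x)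
  where
    negate-diff : ∀ y x → - (y - x) ≡ x - y
    negate-diff = solve-∀

≡mod-*ˡ : ∀ {m x y} l → x ≡ y [mod m ] → l * x ≡ l * y [mod m ]
≡mod-*ˡ {m} {x} {y} l m∣y-x = subst (+ m S.∣_) (factor l y x) (S.∣n⇒∣m*n l m∣y-x)
  where
    factor : ∀ l y x → l * (y - x) ≡ l * y - l * x
    factor = solve-∀

representative : ∀ K P .{{_ : ℕ.NonZero P}} y →
                 ∃ λ y′ → y ≡ y′ [mod P ] × K ℕ.< ∣ y′ ∣ × ∣ y′ ∣ ℕ.≤ K ℕ.+ P
representative K P y =
  y′ , ≡mod-sym {P} {y′} {y} (multiple-apart {P} {y′} {y} q y≡y′+qP) , s≤s (ℕP.m≤m+n K r) , y′≤K+P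
  where
    t : ℤ
    t = y - + suc K
    r : ℕ
    r = t %ℕ P
    q : ℤ
    q = t /ℕ P
    y′ : ℤ
    y′ = + suc K + + r
    y≡y′+qP : y ≡ y′ + q * + P
    y≡y′+qP = begin
        y                            ≡⟨ split y (+ suc K) ⟩
        + suc K + t                  ≡⟨ cong (λ z → + suc K + z) (ℤDM.a≡a%ℕn+[a/ℕn]*n t P) ⟩
        + suc K + (+ r + q * + P)    ≡⟨ ℤP.+-assoc (+ suc K) (+ r) (q * + P) ⟨
        y′ + q * + P                 ∎
      where
        open ≡-Reasoning
        split : ∀ y k → y ≡ k + (y - k)
        split = solve-∀
    y′≤K+P : suc K ℕ.+ r ℕ.≤ K ℕ.+ P
    y′≤K+P = subst (ℕ._≤ K ℕ.+ P) (ℕP.+-suc K r) (ℕP.+-monoʳ-≤ K (ℤDM.n%ℕd<d t P))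

period : List Coset → ℕ
period []             = 1
period ((d , _) ∷ cs) = suc d ℕ.* period cs

period-nonZero : ∀ cs → ℕ.NonZero (period cs)
period-nonZero []             = _
period-nonZero ((d , _) ∷ cs) = ℕP.m*n≢0 (suc d) (period cs) {{_}} {{period-nonZero cs}}

InCoset-periodic : ∀ {m x y} c → + suc (proj₁ c) S.∣ + m →
                   InCoset x c → x ≡ y [mod m ] → InCoset y c
InCoset-periodic {m} {x} {y} (d , r) d∣m x∈c x≡y =
  S.∣⇒∣ᵤ {+ suc d} {y - r} (subst (+ suc d S.∣_) (telescope x y r)
           (S.∣m∣n⇒∣m+n (S.∣ᵤ⇒∣ {+ suc d} {x - r} x∈c) (S.∣-trans d∣m x≡y)))
  where
    telescope : ∀ x y r → (x - r) + (y - x) ≡ y - r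
    telescope = solve-∀

InCosets-periodic : ∀ cs {x y} → InCosets cs x → x ≡ y [mod period cs ] → InCosets cs y
InCosets-periodic ((d , r) ∷ cs) {x} {y} (here x∈c) x≡y =
  here (InCoset-periodic {x = x} {y = y} (d , r) modulus∣period x∈c x≡y)
  where
    modulus∣period : + suc d S.∣ + period ((d , r) ∷ cs)
    modulus∣period = S.∣ᵤ⇒∣ {+ suc d} {+ period ((d , r) ∷ cs)} (ℕD.m∣m*n (period cs))
InCosets-periodic ((d , r) ∷ cs) {x} {y} (there x∈cs) x≡y =
  there (InCosets-periodic cs {x} {y} x∈cs (S.∣-trans period∣period x≡y))
  where
    period∣period : + period cs S.∣ + period ((d , r) ∷ cs)
    period∣period = S.∣ᵤ⇒∣ {+ period cs} {+ period ((d , r) ∷ cs)} (ℕD.n∣m*n (suc d))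

InCosets? : ∀ cs → Decidable (InCosets cs)
InCosets? cs x = any? (λ { (d , r) → suc d ℕD.∣? ∣ x - r ∣ }) cs

absBound : List ℤ → ℕ
absBound []       = 0
absBound (z ∷ zs) = ∣ z ∣ ℕ.+ absBound zs

∈⇒≤absBound : ∀ {z} zs → z ∈ zs → ∣ z ∣ ℕ.≤ absBound zs
∈⇒≤absBound (z ∷ zs) (here refl) = ℕP.m≤m+n ∣ z ∣ (absBound zs)
∈⇒≤absBound (z ∷ zs) (there z∈zs) = ℕP.≤-trans (∈⇒≤absBound zs z∈zs) (ℕP.m≤n+m _ ∣ z ∣)

beyond-absBound : ∀ {z} zs → absBound zs ℕ.< ∣ z ∣ → z ∉ zs
beyond-absBound zs beyond z∈zs = ℕP.<⇒≱ beyond (∈⇒≤absBound zs z∈zs)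

window : (N : ℕ) → Fin (suc (N ℕ.+ N)) → ℤ
window N k = + toℕ k - + N

window-covers : ∀ N w → ∣ w ∣ ℕ.≤ N → ∃ λ k → window N k ≡ w
window-covers N w ∣w∣≤N = fromℕ< (s≤s bound) , (begin
    + toℕ (fromℕ< (s≤s bound)) - + N   ≡⟨ cong (λ n → + n - + N) (toℕ-fromℕ< (s≤s bound)) ⟩
    + ∣ w + + N ∣ - + N                ≡⟨ cong (λ z → z - + N) (ℤP.0≤i⇒+∣i∣≡i (shifted-nonneg w ∣w∣≤N)) ⟩
    w + + N - + N                      ≡⟨ cancel w (+ N) ⟩
    w                                  ∎)
  where
    open ≡-Reasoning
    bound : ∣ w + + N ∣ ℕ.≤ N ℕ.+ N
    bound = ℕP.≤-trans (ℤP.∣i+j∣≤∣i∣+∣j∣ w (+ N)) (ℕP.+-monoˡ-≤ N ∣w∣≤N)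
    shifted-nonneg : ∀ w → ∣ w ∣ ℕ.≤ N → 0ℤ ℤ.≤ w + + N
    shifted-nonneg (+ m)    _  = ℤ.+≤+ z≤n
    shifted-nonneg -[1+ m ] le rewrite ℤP.⊖-≥ le = ℤ.+≤+ z≤n
    cancel : ∀ w n → w + n - n ≡ w
    cancel = solve-∀

PreservesWindow : (ℤ → Set) → ℕ → ℤ → Set
PreservesWindow R N l = ∀ k → R (window N k) → R (l * window N k)

PPDefinable-≐ : ∀ {R S T : ℤ → Set} → PPDefinable R S → (∀ x → S x ⇔ T x) → PPDefinable R T
PPDefinable-≐ (m , atoms , defines) S⇔T = m , atoms , λ x → defines x ⇔-∘ ⇔-sym (S⇔T x)

progression : ∀ {n} (f : Fin (suc n) → ℤ) x → (∀ k → f (inject₁ k) + x ≡ f (suc k)) →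
              ∀ k → f k ≡ f zero + + toℕ k * x
progression f x step zero = sym (ℤP.+-identityʳ (f zero))
progression {suc n} f x step (suc k) = begin
    f (suc k)                              ≡⟨ progression (f ∘ suc) x (step ∘ suc) k ⟩
    f (suc zero) + + toℕ k * x             ≡⟨ cong (λ z → z + + toℕ k * x) (step zero) ⟨
    f zero + x + + toℕ k * x               ≡⟨ regroup (f zero) x (+ toℕ k) ⟩
    f zero + + toℕ (suc k) * x             ∎
  where
    open ≡-Reasoning
    regroup : ∀ a x t → a + x + t * x ≡ a + (+ 1 + t) * x
    regroup = solve-∀

-- The formula: variable 0 is the free variable x, variable 1 + k stands for
-- x · window k.  Consecutive variables differ by x, the centre variable is 0,
-- and variable 1 + k is required to lie in R whenever window k does.
module WindowFormula (R : ℤ → Set) (R? : Decidable R) (N : ℕ) where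

  size : ℕ
  size = suc (suc (N ℕ.+ N))

  Var : Set
  Var = Fin size

  centre : Fin (suc (N ℕ.+ N))
  centre = fromℕ N ↑ˡ N

  toℕ-centre : toℕ centre ≡ N
  toℕ-centre = trans (toℕ-↑ˡ (fromℕ N) N) (toℕ-fromℕ N)

  window-centre : window N centre ≡ 0ℤ
  window-centre = trans (cong (λ n → + n - + N) toℕ-centre) (ℤP.+-inverseʳ (+ N))

  step : Fin (N ℕ.+ N) → PPAtom size
  step k = plusᵖ (suc (inject₁ k)) zero (suc (suc k))

  guard : Fin (suc (N ℕ.+ N)) → PPAtom size
  guard k with R? (window N k)
  ... | yes _ = relᵖ (suc k)
  ... | no  _ = eqᵖ zero zero

  -- The centre variable is idempotent, hence 0.
  atoms : List (PPAtom size)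
  atoms = plusᵖ (suc centre) (suc centre) (suc centre) ∷ tabulate step ++ tabulate guard

  guard-intro : ∀ v k → (R (window N k) → R (v (suc k))) → HoldsPP R v (guard k)
  guard-intro v k implies with R? (window N k)
  ... | yes Rw = implies Rw
  ... | no  _  = refl

  guard-elim : ∀ v k → HoldsPP R v (guard k) → R (window N k) → R (v (suc k))
  guard-elim v k holds with R? (window N k)
  ... | yes _  = λ _ → holds
  ... | no ¬Rw = λ Rw → ⊥-elim (¬Rw Rw)

  solution : ℤ → Var → ℤ
  solution x zero    = x
  solution x (suc k) = x * window N k

  solution-holds : ∀ x → PreservesWindow R N x → All (HoldsPP R (solution x)) atoms
  solution-holds x preserves =
    centre-zero ∷ ++⁺ (tabulate⁺ consecutive)
                      (tabulate⁺ {f = guard} (λ k → guard-intro (solution x) k (preserves k)))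
    where
      centre-zero : x * window N centre + x * window N centre ≡ x * window N centre
      centre-zero rewrite window-centre | ℤP.*-zeroʳ x = refl
      consecutive : ∀ k → x * window N (inject₁ k) + x ≡ x * window N (suc k)
      consecutive k rewrite toℕ-inject₁ k = next x (+ toℕ k) (+ N)
        where
          next : ∀ x t n → x * (t - n) + x ≡ x * (+ 1 + t - n)
          next = solve-∀

  forced : ∀ v → All (HoldsPP R v) atoms → ∀ k → v (suc k) ≡ v zero * window N k
  forced v (centre-idem ∷ rest) k = begin
      v (suc k)                              ≡⟨ along k ⟩
      u + + toℕ k * x                        ≡⟨ recentre u (+ toℕ k) (+ N) x ⟩
      (u + + N * x) + x * window N k         ≡⟨ cong (λ z → z + x * window N k) start ⟩
      0ℤ + x * window N k                    ≡⟨ ℤP.+-identityˡ (x * window N k) ⟩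
      x * window N k                         ∎
    where
      open ≡-Reasoning
      x u : ℤ
      x = v zero
      u = v (suc zero)
      along : ∀ k → v (suc k) ≡ u + + toℕ k * x
      along = progression (v ∘ suc) x (tabulate⁻ (proj₁ (++⁻ (tabulate step) rest)))
      start : u + + N * x ≡ 0ℤ
      start = begin
          u + + N * x                ≡⟨ cong (λ n → u + + n * x) toℕ-centre ⟨
          u + + toℕ centre * x       ≡⟨ along centre ⟨
          v (suc centre)             ≡⟨ identityʳ-unique _ _ centre-idem ⟩
          0ℤ                         ∎
      recentre : ∀ u k n x → u + k * x ≡ (u + n * x) + x * (k - n)
      recentre = solve-∀

  defines : ∀ x → PreservesWindow R N x ⇔ ∃ λ (v : Var → ℤ) → v zero ≡ x × All (HoldsPP R v) atoms
  defines x = mk⇔ (λ preserves → solution x , refl , solution-holds x preserves)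
                  λ { (v , refl , holds@(_ ∷ rest)) k Rw →
                        subst R (forced v holds k)
                          (guard-elim v k (tabulate⁻ {f = guard} (proj₂ (++⁻ (tabulate step) rest)) k) Rw) }

PreservesWindow-ppDefinable : ∀ R → Decidable R → ∀ N → PPDefinable R (PreservesWindow R N)
PreservesWindow-ppDefinable R R? N = suc (N ℕ.+ N) , atoms , defines
  where open WindowFormula R R? N

mul-endomorphism : ∀ {R} l → (∀ x → R x → R (l * x)) → IsEndomorphism R (l *_)
mul-endomorphism l preserves = additive , preserves
  where
    additive : ∀ x y z → x + y ≡ z → l * x + l * y ≡ l * z
    additive x y z refl = sym (ℤP.*-distribˡ-+ l x y)

module _ {R : ℤ → Set} (core : IsCore R) where

  -- The constant map to 0 would be a non-injective endomorphism.
  core⇒0∉R : ¬ R 0ℤ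
  core⇒0∉R R0 = case injective {0ℤ} {+ 1} refl of λ ()
    where
      injective : Injective _≡_ _≡_ (λ (_ : ℤ) → 0ℤ)
      injective = proj₁ (core (λ _ → 0ℤ) ((λ _ _ _ _ → refl) , (λ _ _ → R0)))

  core-mul : ∀ {l} → (∀ x → R x → R (l * x)) → l ≢ 0ℤ × (∀ x → R (l * x) → R x)
  core-mul {l} preserves = l≢0 , λ x → Equivalence.from (proj₂ (proj₂ embedding) x)
    where
      embedding : IsSelfEmbedding R (l *_)
      embedding = core (l *_) (mul-endomorphism l preserves)
      l≢0 : l ≢ 0ℤ
      l≢0 refl = case proj₁ embedding {0ℤ} {+ 1} refl of λ ()

units-containing-one : ∀ {S : ℤ → Set} → Dec (S (- + 1)) → S (+ 1) → (∀ l → S l → IsPlusMinusOne l) →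
                       (∀ x → S x ⇔ IsOne x) ⊎ (∀ x → S x ⇔ IsPlusMinusOne x)
units-containing-one {S} (yes S-1) S1 units =
  inj₂ λ x → mk⇔ (units x) λ { (inj₁ refl) → S1 ; (inj₂ refl) → S-1 }
units-containing-one {S} (no ¬S-1) S1 units =
  inj₁ λ x → mk⇔ (one x) λ { refl → S1 }
  where
    one : ∀ x → S x → IsOne x
    one x Sx with units x Sx
    ... | inj₁ x≡1  = x≡1
    ... | inj₂ refl = ⊥-elim (¬S-1 Sx)

module Decomposed {R : ℤ → Set} {R° : List Coset} {R⁺ R⁻ : List ℤ}
                  (decomposition : IsDecomposition R R° R⁺ R⁻) where

  P : ℕ
  P = period R°

  instance
    P-nonZero : ℕ.NonZero P
    P-nonZero = period-nonZero R°

  -- Beyond absolute value K, R agrees with R°.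
  K : ℕ
  K = absBound R⁺ ℕ.+ absBound R⁻

  far-∉R⁺ : ∀ {x} → K ℕ.< ∣ x ∣ → x ∉ R⁺
  far-∉R⁺ far = beyond-absBound R⁺ (ℕP.≤-<-trans (ℕP.m≤m+n _ _) far)

  far-∉R⁻ : ∀ {x} → K ℕ.< ∣ x ∣ → x ∉ R⁻
  far-∉R⁻ far = beyond-absBound R⁻ (ℕP.≤-<-trans (ℕP.m≤n+m _ _) far)

  far-scaled : ∀ {l x} → l ≢ 0ℤ → K ℕ.< ∣ x ∣ → K ℕ.< ∣ l * x ∣
  far-scaled {l} {x} l≢0 far = ℕP.<-≤-trans far (∣x∣≤∣l*x∣ l x l≢0)

  R-elim : ∀ {x} → R x → (InCosets R° x ⊎ x ∈ R⁺) × x ∉ R⁻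
  R-elim {x} = Equivalence.to (proj₁ decomposition x)

  R⁺⊆R : ∀ {x} → x ∈ R⁺ → R x
  R⁺⊆R {x} x∈R⁺ =
    Equivalence.from (proj₁ decomposition x) (inj₂ x∈R⁺ , proj₁ (proj₂ decomposition) x x∈R⁺)

  R⁺∩R°≡∅ : ∀ {x} → x ∈ R⁺ → ¬ InCosets R° x
  R⁺∩R°≡∅ {x} = proj₁ (proj₂ (proj₂ decomposition)) x

  R⁻⊆R° : ∀ {x} → x ∈ R⁻ → InCosets R° x
  R⁻⊆R° {x} = proj₂ (proj₂ (proj₂ decomposition)) x

  R⇒coset : ∀ {x} → R x → x ∉ R⁺ → InCosets R° x
  R⇒coset Rx x∉R⁺ with R-elim Rx
  ... | inj₁ x∈R° , _ = x∈R°
  ... | inj₂ x∈R⁺ , _ = ⊥-elim (x∉R⁺ x∈R⁺)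

  coset⇒R : ∀ {x} → InCosets R° x → x ∉ R⁻ → R x
  coset⇒R {x} x∈R° x∉R⁻ = Equivalence.from (proj₁ decomposition x) (inj₁ x∈R° , x∉R⁻)

  coset-transfer : ∀ {x y} → InCosets R° x → x ≡ y [mod P ] → K ℕ.< ∣ y ∣ → R y
  coset-transfer {x} {y} x∈R° x≡y far =
    coset⇒R (InCosets-periodic R° {x} {y} x∈R° x≡y) (far-∉R⁻ far)

  -- R is decidable, as the pp-formula for window preservation requires.
  R? : Decidable R
  R? x = map′ (Equivalence.from (proj₁ decomposition x)) (Equivalence.to (proj₁ decomposition x))
              ((InCosets? R° x ⊎-dec x ∈? R⁺) ×-dec ¬? (x ∈? R⁻))

  module WithoutR⁺ (core : IsCore R) (no-R⁺ : ∀ x → x ∉ R⁺) where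

    -- Multiplication by stretch = 1 + (K+1)P fixes residues mod P and pushes
    -- every nonzero integer beyond K.
    stretch : ℤ
    stretch = + suc (suc K ℕ.* P)

    stretch-fixes-residues : ∀ x → x ≡ stretch * x [mod P ]
    stretch-fixes-residues x = multiple-apart {P} {x} {stretch * x} (+ suc K * x) (begin
        stretch * x                    ≡⟨ cong (λ s → (+ 1 + s) * x) (ℤP.pos-* (suc K) P) ⟩
        (+ 1 + + suc K * + P) * x      ≡⟨ expand x (+ suc K) (+ P) ⟩
        x + + suc K * x * + P          ∎)
      where
        open ≡-Reasoning
        expand : ∀ x k p → (+ 1 + k * p) * x ≡ x + k * x * p
        expand = solve-∀

    stretch-far : ∀ {x} → x ≢ 0ℤ → K ℕ.< ∣ stretch * x ∣
    stretch-far {x} x≢0 = ℕP.<-≤-trans K<stretch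
      (subst (∣ stretch ∣ ℕ.≤_) (cong ∣_∣ (ℤP.*-comm x stretch)) (∣x∣≤∣l*x∣ x stretch x≢0))
      where
        K<stretch : K ℕ.< ∣ stretch ∣
        K<stretch = s≤s (ℕP.≤-trans (ℕP.n≤1+n K) (ℕP.m≤m*n (suc K) P))

    stretch-preserves : ∀ x → R x → R (stretch * x)
    stretch-preserves x Rx =
      coset-transfer {x} {stretch * x} (R⇒coset Rx (no-R⁺ x))
        (stretch-fixes-residues x) (stretch-far x≢0)
      where
        x≢0 : x ≢ 0ℤ
        x≢0 refl = core⇒0∉R core Rx

    -- A nonzero y ∈ R⁻ ⊆ R° would be stretched into R, and R is reflected.
    R⁻⊆0 : ∀ {y} → y ∈ R⁻ → y ≡ 0ℤ
    R⁻⊆0 {y} y∈R⁻ with y ℤ.≟ 0ℤ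
    ... | yes y≡0 = y≡0
    ... | no  y≢0 = ⊥-elim (proj₂ (R-elim Ry) y∈R⁻)
      where
        Ry : R y
        Ry = proj₂ (core-mul core {stretch} stretch-preserves) y
               (coset-transfer {y} {stretch * y} (R⁻⊆R° y∈R⁻)
                  (stretch-fixes-residues y) (stretch-far y≢0))

    -- If 0 ∈ R⁻ ⊆ R°, every nonzero multiple of P lies in R; multiplication by P
    -- therefore preserves R, and since it reflects R, all of ℤ ∖ {0} is in R.
    R≡nonzero : 0ℤ ∈ R⁻ → ∀ x → R x ⇔ (x ≢ + 0)
    R≡nonzero 0∈R⁻ x = mk⇔ (λ Rx x≡0 → core⇒0∉R core (subst R x≡0 Rx))
                           (λ x≢0 → reflects x (multiple∈R x≢0))
      where
        multiple∈R : ∀ {x} → x ≢ 0ℤ → R (+ P * x)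
        multiple∈R {x} x≢0 = coset⇒R
          (InCosets-periodic R° {0ℤ} {+ P * x} (R⁻⊆R° 0∈R⁻)
             (multiple-apart {P} {0ℤ} {+ P * x} x (swap (+ P) x)))
          (λ Px∈R⁻ → Px≢0 (R⁻⊆0 Px∈R⁻))
          where
            swap : ∀ p x → p * x ≡ + 0 + x * p
            swap = solve-∀
            Px≢0 : + P * x ≢ 0ℤ
            Px≢0 Px≡0 with ℤP.i*j≡0⇒i≡0∨j≡0 (+ P) Px≡0
            ... | inj₁ P≡0 = ℕ.≢-nonZero⁻¹ P (cong ∣_∣ P≡0)
            ... | inj₂ x≡0 = x≢0 x≡0
        reflects : ∀ x → R (+ P * x) → R x
        reflects = proj₂ (core-mul core {+ P} λ x Rx →
                            multiple∈R λ { refl → core⇒0∉R core Rx })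

    result : (∀ x → x ∉ R⁻) ⊎ (∀ x → R x ⇔ (x ≢ + 0))
    result with 0ℤ ∈? R⁻
    ... | yes 0∈R⁻ = inj₂ (R≡nonzero 0∈R⁻)
    ... | no  0∉R⁻ = inj₁ λ x x∈R⁻ → 0∉R⁻ (subst (_∈ R⁻) (R⁻⊆0 x∈R⁻) x∈R⁻)

  module WithR⁺ (core : IsCore R) {a₀ : ℤ} (a₀∈R⁺ : a₀ ∈ R⁺) where

    a : ℤ
    a = Extrema.argmax ∣_∣ a₀ R⁺

    a∈R⁺ : a ∈ R⁺
    a∈R⁺ = Extrema.argmax-all ∣_∣ {P = _∈ R⁺} a₀∈R⁺ (All.tabulate λ b∈R⁺ → b∈R⁺)

    a-maximal : ∀ {b} → b ∈ R⁺ → ∣ b ∣ ℕ.≤ ∣ a ∣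
    a-maximal = All.lookup (Extrema.f[xs]≤f[argmax] {f = ∣_∣} a₀ R⁺)

    -- The window radius: every residue class has a representative in the
    -- window beyond K.
    N : ℕ
    N = K ℕ.+ P

    on-window : ∀ l {w} → PreservesWindow R N l → ∣ w ∣ ℕ.≤ N → R w → R (l * w)
    on-window l {w} preserves small Rw with window-covers N w small
    ... | k , refl = preserves k Rw

    -- Beyond K, y is replaced by a representative y′ of its residue class
    -- inside the window: l·y′ ∈ R, so l ≠ 0 and l·y lies in the class of l·y′.
    beyond-window : ∀ l {y} → PreservesWindow R N l → K ℕ.< ∣ y ∣ → R y → R (l * y)
    beyond-window l {y} preserves y-far Ry = via (representative K P y)
      where
        via : (∃ λ y′ → y ≡ y′ [mod P ] × K ℕ.< ∣ y′ ∣ × ∣ y′ ∣ ℕ.≤ N) → R (l * y)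
        via (y′ , y≡y′ , y′-far , y′-small) =
          coset-transfer {l * y′} {l * y}
            (R⇒coset Rly′ (far-∉R⁺ (far-scaled l≢0 y′-far)))
            (≡mod-*ˡ l (≡mod-sym {P} {y} {y′} y≡y′)) (far-scaled l≢0 y-far)
          where
            Rly′ : R (l * y′)
            Rly′ = on-window l preserves y′-small
                     (coset-transfer {y} {y′} (R⇒coset Ry (far-∉R⁺ y-far)) y≡y′ y′-far)
            l≢0 : l ≢ 0ℤ
            l≢0 refl = core⇒0∉R core Rly′

    window-preserver-preserves : ∀ l → PreservesWindow R N l → ∀ y → R y → R (l * y)
    window-preserver-preserves l preserves y Ry with ∣ y ∣ ℕP.≤? N
    ... | yes small = on-window l preserves small Ry
    ... | no  large =
      beyond-window l preserves (ℕP.≤-<-trans (ℕP.m≤m+n K P) (ℕP.≰⇒> large)) Ry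

    -- If |l| ≥ 2, then l·a ∉ R⁺ by maximality, so l·a ∈ R°.  A representative
    -- y of the class of a beyond K is not in R (a ∉ R°), yet l·y lies in the
    -- class of l·a beyond K, so l·y ∈ R: multiplication by l cannot reflect R.
    no-stretching : ∀ l → 2 ℕ.≤ ∣ l ∣ →
                    (∀ x → R x → R (l * x)) → (∀ x → R (l * x) → R x) → ⊥
    no-stretching l large preserves reflects = via (representative K P a)
      where
        Ra : R a
        Ra = R⁺⊆R a∈R⁺
        l≢0 : l ≢ 0ℤ
        l≢0 refl = case large of λ ()
        a≢0 : a ≢ 0ℤ
        a≢0 a≡0 = core⇒0∉R core (subst R a≡0 Ra)
        la∈R° : InCosets R° (l * a)
        la∈R° = R⇒coset (preserves a Ra)
                  (λ la∈R⁺ → ℕP.<⇒≱ (∣x∣<∣l*x∣ l a large a≢0) (a-maximal la∈R⁺))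
        via : (∃ λ y → a ≡ y [mod P ] × K ℕ.< ∣ y ∣ × ∣ y ∣ ℕ.≤ N) → ⊥
        via (y , a≡y , y-far , _) =
          R⁺∩R°≡∅ a∈R⁺ (InCosets-periodic R° {y} {a} (R⇒coset Ry (far-∉R⁺ y-far))
                          (≡mod-sym {P} {a} {y} a≡y))
          where
            Ry : R y
            Ry = reflects y (coset-transfer {l * a} {l * y} la∈R°
                               (≡mod-*ˡ l a≡y) (far-scaled l≢0 y-far))

    -- By the core property window preservers reflect R, so they are ±1.
    preservers-are-units : ∀ l → PreservesWindow R N l → IsPlusMinusOne l
    preservers-are-units l preserves =
      unit-or-large l l≢0 (λ large → no-stretching l large preserves-R reflects-R)
      where
        preserves-R : ∀ x → R x → R (l * x)
        preserves-R = window-preserver-preserves l preserves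
        l≢0 : l ≢ 0ℤ
        l≢0 = proj₁ (core-mul core {l} preserves-R)
        reflects-R : ∀ x → R (l * x) → R x
        reflects-R = proj₂ (core-mul core {l} preserves-R)

    one-preserves : PreservesWindow R N (+ 1)
    one-preserves k Rw = subst R (sym (ℤP.*-identityˡ (window N k))) Rw

    -- The pp-definable set of window preservers is {1} or {1, -1}, according
    -- to whether -1 preserves the window (a finite, decidable check).
    result : PPDefinable R IsOne ⊎ PPDefinable R IsPlusMinusOne
    result = Sum.map (PPDefinable-≐ definable) (PPDefinable-≐ definable)
               (units-containing-one minus-one? one-preserves preservers-are-units)
      where
        definable : PPDefinable R (PreservesWindow R N)
        definable = PreservesWindow-ppDefinable R R? N
        minus-one? : Dec (PreservesWindow R N (- + 1))
        minus-one? = all? λ k → R? (window N k) →-dec R? (- + 1 * window N k)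

lemma15 : (R : ℤ → Set) → FODefinable R → IsCore R →
    (R° : List Coset) (R⁺ R⁻ : List ℤ) → IsDecomposition R R° R⁺ R⁻ →
    ((∃ λ x → x ∈ R⁺) → PPDefinable R IsOne ⊎ PPDefinable R IsPlusMinusOne)
    × ((∀ x → x ∉ R⁺) → (∀ x → x ∉ R⁻) ⊎ (∀ x → R x ⇔ (x ≢ + 0)))
-- First-order definability of R enters only through its decomposition.
lemma15 R _ core R° R⁺ R⁻ decomposition =
  (λ { (_ , a₀∈R⁺) → WithR⁺.result core a₀∈R⁺ }) ,
  (λ no-R⁺ → WithoutR⁺.result core no-R⁺)
  where open Decomposed decomposition
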